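{- Let $T(n)=\sum_{k=0}^{n}\left[\binom{ -2n+8k}{n+k}\binom{n}{k}\bmod 2\right]$ for $n\ge 0$. Let $(S(n))_{n\ge0}$ be the periodic sequence with period $1,1,0$, i.e. $S(n)=1$ if $n\equiv 0$ or $1\pmod 3$ and $S(n)=0$ if $n\equiv 2\pmod 3$. Then $T$ is the run length transform of $S$.
   Context: For integers $a$ and $b\ge0$, $\binom{a}{b}=0$ whenever $a<b$ (in particular whenever $a<0$). $[x \bmod 2]$ denotes the residue in $\{0,1\}$. The run length transform of a sequence $(S(n))_{n\ge0}$ is $T(n)=\prod_{i\in\mathcal{L}(n)}S(i)$, where $\mathcal{L}(n)$ is the multiset of lengths of all maximal runs of $1$'s in the binary representation of $n$ (so $T(0)=1$). -}

module Defs where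

open import Data.Nat using (ℕ; zero; suc; _+_; _*_; _∸_; _%_; _/_; _≤ᵇ_)
open import Data.Nat.Combinatorics using (_C_)
open import Data.Integer as ℤ using (ℤ; +_; -[1+_])
open import Data.List using (List; []; _∷_; map; upTo)
open import Data.Nat.ListAction using (sum; product)
open import Data.Bool using (Bool; true; false; if_then_else_)

-- Generalised binomial coefficient (a choose b) for integer a and natural b,
-- with the convention (a choose b) = 0 whenever a < b (in particular a < 0).
binomℤ : ℤ → ℕ → ℕ
binomℤ (+ a)    b = a C b
binomℤ -[1+ _ ] b = 0

-- Binary digits of n, least significant first (fuel-based; fuel n suffices).
bitsAux : ℕ → ℕ → List ℕ
bitsAux zero      n = []
bitsAux (suc f)   zero = []
bitsAux (suc f) (suc n) = (suc n % 2) ∷ bitsAux f (suc n / 2)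

bits : ℕ → List ℕ
bits n = bitsAux n n

-- Lengths of maximal runs of 1's in a list of binary digits.
-- runsAux c ds : c is the length of the current (unfinished) run of 1's.
runsAux : ℕ → List ℕ → List ℕ
runsAux zero    []            = []
runsAux (suc c) []            = suc c ∷ []
runsAux c       (1 ∷ ds)      = runsAux (suc c) ds
runsAux zero    (_ ∷ ds)      = runsAux zero ds
runsAux (suc c) (_ ∷ ds)      = suc c ∷ runsAux zero ds

runLengths : ℕ → List ℕ
runLengths n = runsAux 0 (bits n)

runLengthTransform : (ℕ → ℕ) → ℕ → ℕ
runLengthTransform S n = product (map S (runLengths n))

arg : ℕ → ℕ → ℤ
arg n k = (ℤ.- (+ (2 * n))) ℤ.+ (+ (8 * k))

T : ℕ → ℕ
T n = sum (map (λ k → (binomℤ (arg n k) (n + k) * (n C k)) % 2) (upTo (suc n)))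

S : ℕ → ℕ
S n with n % 3
... | 2 = 0
... | _ = 1

open import Relation.Binary.PropositionalEquality using (_≡_; refl)
_ : runLengths 2871 ≡ 3 ∷ 2 ∷ 2 ∷ 1 ∷ []   -- 2871 = 101100110111b
_ = refl

-- Give the summand of T two offsets: T⁺ e c n = Σₖ [C(−2n+8k+e, n+k+c) C(n,k) mod 2], so that
-- T = T⁺ 0 0.  Write n = 2m+a and k = 2j+b.  Then −2n+8k+e and n+k+c are twice the corresponding
-- quantities for (m, j) with new offsets (e′, c′), plus parity bits r and s, and Lucas' theorem
-- mod 2 factors the summand as [s ≤ r][b ≤ a] times the summand of T⁺ e′ c′ at (m, j).  Hence
-- T⁺ e c (2m+a) is a sum of at most two values T⁺ e′ c′ m: an automaton reading the binary digits
-- of n.  From the state (0, 0) only eleven states are reachable, and on each of them T⁺ is either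
-- 0 or the run length transform of n with j = 0, 1, 2 ones appended below its lowest digit; the
-- latter satisfies the same recursion because S has period 3.
{-# OPTIONS --safe #-}
module Submission where

open import Defs
open import Data.Nat using (ℕ)
open import Relation.Binary.PropositionalEquality using (_≡_)

open import Algebra.Properties.CommutativeSemigroup using (interchange)
open import Data.Bool using (Bool; true; false; _∧_; if_then_else_)
open import Data.Bool.Properties using (if-float; if-eta)
open import Data.Integer as ℤ using (ℤ; +_; -[1+_])
open import Data.Integer.DivMod using (_/ℕ_; _%ℕ_; a≡a%ℕn+[a/ℕn]*n; n%ℕd<d)
open import Data.Integer.Properties using (pos-+; pos-*) renaming (+-identityʳ to ℤ-+-identityʳ)
import Data.Integer.Tactic.RingSolver as ℤ-Solver
open import Data.List using (_∷_; map; applyUpTo; _∷ʳ_)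
open import Data.List.Properties using (applyUpTo-∷ʳ; map-upTo)
open import Data.Nat
open import Data.Nat.Combinatorics using (_C_; nC1≡n; k>n⇒nCk≡0; nCk+nC[k+1]≡[n+1]C[k+1])
open import Data.Nat.DivMod
open import Data.Nat.Divisibility using (divides-refl)
open import Data.Nat.Induction using (<-rec)
open import Data.Nat.ListAction using (sum; product)
open import Data.Nat.ListAction.Properties using (sum-++)
open import Data.Nat.Properties
import Data.Nat.Tactic.RingSolver as ℕ-Solver
open import Function using (_∘_)
open import Relation.Binary.PropositionalEquality
open import Relation.Nullary using (yes; no)
open ≡-Reasoning

+-cong-% : ∀ {a a′ b b′} d .{{_ : NonZero d}} →
           a % d ≡ a′ % d → b % d ≡ b′ % d → (a + b) % d ≡ (a′ + b′) % d
+-cong-% {a} {a′} {b} {b′} d p q = begin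
  (a + b) % d             ≡⟨ %-distribˡ-+ a b d ⟩
  (a % d + b % d) % d     ≡⟨ cong₂ (λ u v → (u + v) % d) p q ⟩
  (a′ % d + b′ % d) % d   ≡⟨ %-distribˡ-+ a′ b′ d ⟨
  (a′ + b′) % d           ∎

*-cong-% : ∀ {a a′ b b′} d .{{_ : NonZero d}} →
           a % d ≡ a′ % d → b % d ≡ b′ % d → (a * b) % d ≡ (a′ * b′) % d
*-cong-% {a} {a′} {b} {b′} d p q = begin
  (a * b) % d               ≡⟨ %-distribˡ-* a b d ⟩
  (a % d * (b % d)) % d     ≡⟨ cong₂ (λ u v → (u * v) % d) p q ⟩
  (a′ % d * (b′ % d)) % d   ≡⟨ %-distribˡ-* a′ b′ d ⟨
  (a′ * b′) % d             ∎

[2m+r]%2≡r : ∀ m {r} → r ≤ 1 → (2 * m + r) % 2 ≡ r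
[2m+r]%2≡r m {r} r≤1 = begin
  (2 * m + r) % 2   ≡⟨ cong (_% 2) (trans (+-comm (2 * m) r) (cong (_+_ r) (*-comm 2 m))) ⟩
  (r + m * 2) % 2   ≡⟨ [m+kn]%n≡m%n r m 2 ⟩
  r % 2             ≡⟨ m≤n⇒m%n≡m r≤1 ⟩
  r                 ∎

[2m+r]/2≡m : ∀ m {r} → r ≤ 1 → (2 * m + r) / 2 ≡ m
[2m+r]/2≡m m {r} r≤1 = begin
  (2 * m + r) / 2     ≡⟨ /-congˡ (trans (+-comm (2 * m) r) (cong (_+_ r) (*-comm 2 m))) ⟩
  (r + m * 2) / 2     ≡⟨ +-distrib-/-∣ʳ r (divides-refl m) ⟩
  r / 2 + m * 2 / 2   ≡⟨ cong₂ _+_ (m<n⇒m/n≡0 (s≤s r≤1)) (m*n/n≡m m 2) ⟩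
  m                   ∎

[1+n]/2≤n : ∀ n → suc n / 2 ≤ n
[1+n]/2≤n zero    = z≤n
[1+n]/2≤n (suc n) = ≤-pred (m/n<m (suc (suc n)) 2 (s≤s (s≤s z≤n)))

2[1+m]+r : ∀ m r → 2 * suc m + r ≡ suc (suc (2 * m + r))
2[1+m]+r m r = cong (_+ r) (*-suc 2 m)

if-+ : ∀ b x y → (if b then x else 0) + (if b then y else 0) ≡ (if b then x + y else 0)
if-+ true  x y = refl
if-+ false x y = refl

if-* : ∀ b c x y → (if b then x else 0) * (if c then y else 0) ≡ (if b ∧ c then x * y else 0)
if-* true  true  x y = refl
if-* true  false x y = *-zeroʳ x
if-* false c     x y = refl

binary-induction : ∀ {ℓ} (P : ℕ → Set ℓ) → P 0 → (∀ m {a} → a ≤ 1 → P m → P (2 * m + a)) → ∀ n → P n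
binary-induction P base step = <-rec P induct
  where
  induct : ∀ n → (∀ {m} → m < n → P m) → P n
  induct zero    _   = base
  induct (suc n) rec =
    subst P (sym halves) (step h (≤-pred (m%n<n (suc n) 2)) (rec (m/n<m (suc n) 2 (s≤s (s≤s z≤n)))))
    where
    h = suc n / 2
    halves : suc n ≡ 2 * h + suc n % 2
    halves = trans (m≡m%n+[m/n]*n (suc n) 2) (trans (+-comm (suc n % 2) (h * 2)) (cong (_+ suc n % 2) (*-comm h 2)))

-- Lucas' theorem modulo 2

pascal²-%2 : ∀ n k → (suc (suc n) C suc (suc k)) % 2 ≡ (n C k + n C suc (suc k)) % 2
pascal²-%2 n k = begin
  (suc (suc n) C suc (suc k)) % 2
    ≡⟨ cong (_% 2) (sym (nCk+nC[k+1]≡[n+1]C[k+1] (suc n) (suc k))) ⟩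
  (suc n C suc k + suc n C suc (suc k)) % 2
    ≡⟨ cong (_% 2) (sym (cong₂ _+_ (nCk+nC[k+1]≡[n+1]C[k+1] n k) (nCk+nC[k+1]≡[n+1]C[k+1] n (suc k)))) ⟩
  ((n C k + n C suc k) + (n C suc k + n C suc (suc k))) % 2
    ≡⟨ cong (_% 2) (regroup (n C k) (n C suc k) (n C suc (suc k))) ⟩
  ((n C k + n C suc (suc k)) + (n C suc k) * 2) % 2
    ≡⟨ [m+kn]%n≡m%n (n C k + n C suc (suc k)) (n C suc k) 2 ⟩
  (n C k + n C suc (suc k)) % 2 ∎
  where
  regroup : ∀ a b c → (a + b) + (b + c) ≡ (a + c) + b * 2
  regroup = ℕ-Solver.solve-∀

lucas₂ : ∀ x y {r s} → r ≤ 1 → s ≤ 1 →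
         ((2 * x + r) C (2 * y + s)) % 2 ≡ (if s ≤ᵇ r then x C y else 0) % 2
lucas₂ x zero {r}           {zero}        _   _   = refl
lucas₂ x zero {zero}        {suc zero}    r≤1 _   = trans (cong (_% 2) (nC1≡n (2 * x + 0))) ([2m+r]%2≡r x r≤1)
lucas₂ x zero {suc zero}    {suc zero}    r≤1 _   = trans (cong (_% 2) (nC1≡n (2 * x + 1))) ([2m+r]%2≡r x r≤1)
lucas₂ x zero {suc (suc _)} {_}           (s≤s ()) _
lucas₂ x zero {_}           {suc (suc _)} _   (s≤s ())
lucas₂ zero (suc y) {r} {s} r≤1 _ = begin
  (r C (2 * suc y + s)) % 2       ≡⟨ cong (_% 2) (k>n⇒nCk≡0 r<2[1+y]+s) ⟩
  0                               ≡⟨ cong (_% 2) (if-eta (s ≤ᵇ r)) ⟨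
  (if s ≤ᵇ r then 0 else 0) % 2   ∎
  where
  r<2[1+y]+s : r < 2 * suc y + s
  r<2[1+y]+s = ≤-trans (s≤s r≤1) (≤-trans (s≤s (s≤s z≤n)) (≤-reflexive (sym (2[1+m]+r y s))))
lucas₂ (suc x) (suc y) {r} {s} r≤1 s≤1 = begin
  ((2 * suc x + r) C (2 * suc y + s)) % 2
    ≡⟨ cong₂ (λ u v → (u C v) % 2) (2[1+m]+r x r) (2[1+m]+r y s) ⟩
  (suc (suc N) C suc (suc K)) % 2
    ≡⟨ pascal²-%2 N K ⟩
  (N C K + N C suc (suc K)) % 2
    ≡⟨ +-cong-% {N C K} {if w then x C y else 0} {N C suc (suc K)} {if w then x C suc y else 0} 2
         (lucas₂ x y r≤1 s≤1) (trans (cong (λ v → (N C v) % 2) (sym (2[1+m]+r y s))) (lucas₂ x (suc y) r≤1 s≤1)) ⟩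
  ((if w then x C y else 0) + (if w then x C suc y else 0)) % 2
    ≡⟨ cong (_% 2) (if-+ w (x C y) (x C suc y)) ⟩
  (if w then x C y + x C suc y else 0) % 2
    ≡⟨ cong (λ v → (if w then v else 0) % 2) (nCk+nC[k+1]≡[n+1]C[k+1] x y) ⟩
  (if w then suc x C suc y else 0) % 2 ∎
  where
  N = 2 * x + r
  K = 2 * y + s
  w = s ≤ᵇ r

lucas₂ℤ : ∀ X y {r s} → r ≤ 1 → s ≤ 1 →
          binomℤ (X ℤ.+ X ℤ.+ + r) (2 * y + s) % 2 ≡ (if s ≤ᵇ r then binomℤ X y else 0) % 2
lucas₂ℤ (+ x) y {r} {s} r≤1 s≤1 =
  trans (cong (λ z → ((x + z + r) C (2 * y + s)) % 2) (sym (+-identityʳ x))) (lucas₂ x y r≤1 s≤1)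
lucas₂ℤ -[1+ m ] y {zero}     {s} _ _ = cong (_% 2) (sym (if-eta (s ≤ᵇ 0)))
lucas₂ℤ -[1+ m ] y {suc zero} {s} _ _ = cong (_% 2) (sym (if-eta (s ≤ᵇ 1)))
lucas₂ℤ -[1+ m ] y {suc (suc _)} (s≤s ()) _

sum-applyUpTo-cong : ∀ {f g : ℕ → ℕ} n → (∀ k → f k ≡ g k) → sum (applyUpTo f n) ≡ sum (applyUpTo g n)
sum-applyUpTo-cong zero    f≗g = refl
sum-applyUpTo-cong (suc n) f≗g = cong₂ _+_ (f≗g 0) (sum-applyUpTo-cong n (f≗g ∘ suc))

sum-applyUpTo-if : ∀ b f n → sum (applyUpTo (λ k → if b then f k else 0) n) ≡ (if b then sum (applyUpTo f n) else 0)
sum-applyUpTo-if true  f n       = refl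
sum-applyUpTo-if false f zero    = refl
sum-applyUpTo-if false f (suc n) = sum-applyUpTo-if false (f ∘ suc) n

sum-applyUpTo-suc : ∀ f n → sum (applyUpTo f (suc n)) ≡ sum (applyUpTo f n) + f n
sum-applyUpTo-suc f n = begin
  sum (applyUpTo f (suc n))         ≡⟨ cong sum (applyUpTo-∷ʳ f n) ⟨
  sum (applyUpTo f n ∷ʳ f n)        ≡⟨ sum-++ (applyUpTo f n) _ ⟩
  sum (applyUpTo f n) + (f n + 0)   ≡⟨ cong (_+_ (sum (applyUpTo f n))) (+-identityʳ (f n)) ⟩
  sum (applyUpTo f n) + f n         ∎

sum-applyUpTo-vanishing : ∀ {f m n} → m ≤ n → (∀ k → m ≤ k → f k ≡ 0) → sum (applyUpTo f n) ≡ sum (applyUpTo f m)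
sum-applyUpTo-vanishing {m = zero} {zero} _ _ = refl
sum-applyUpTo-vanishing {f} {m} {suc n} m≤1+n vanish with m ≤? n
... | yes m≤n = begin
  sum (applyUpTo f (suc n))   ≡⟨ sum-applyUpTo-suc f n ⟩
  sum (applyUpTo f n) + f n   ≡⟨ cong₂ _+_ (sum-applyUpTo-vanishing m≤n vanish) (vanish n m≤n) ⟩
  sum (applyUpTo f m) + 0     ≡⟨ +-identityʳ _ ⟩
  sum (applyUpTo f m)         ∎
... | no m≰n = cong (sum ∘ applyUpTo f) (≤-antisym (≰⇒> m≰n) m≤1+n)

sum-applyUpTo-evens-odds : ∀ f m → sum (applyUpTo f (2 * m))
                         ≡ sum (applyUpTo (λ k → f (2 * k + 0)) m) + sum (applyUpTo (λ k → f (2 * k + 1)) m)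
sum-applyUpTo-evens-odds f zero    = refl
sum-applyUpTo-evens-odds f (suc m) = begin
  sum (applyUpTo f (2 * suc m))
    ≡⟨ cong (sum ∘ applyUpTo f) (*-suc 2 m) ⟩
  sum (applyUpTo f (suc (suc (2 * m))))
    ≡⟨ trans (sum-applyUpTo-suc f (suc (2 * m))) (cong (_+ f (suc (2 * m))) (sum-applyUpTo-suc f (2 * m))) ⟩
  sum (applyUpTo f (2 * m)) + f (2 * m) + f (suc (2 * m))
    ≡⟨ cong (λ x → x + f (2 * m) + f (suc (2 * m))) (sum-applyUpTo-evens-odds f m) ⟩
  Evens + Odds + f (2 * m) + f (suc (2 * m))
    ≡⟨ +-assoc (Evens + Odds) (f (2 * m)) (f (suc (2 * m))) ⟩
  (Evens + Odds) + (f (2 * m) + f (suc (2 * m)))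
    ≡⟨ interchange +-commutativeSemigroup Evens Odds (f (2 * m)) (f (suc (2 * m))) ⟩
  (Evens + f (2 * m)) + (Odds + f (suc (2 * m)))
    ≡⟨ cong₂ (λ u v → (Evens + f u) + (Odds + f v)) (sym (+-identityʳ (2 * m))) (+-comm 1 (2 * m)) ⟩
  (Evens + f (2 * m + 0)) + (Odds + f (2 * m + 1))
    ≡⟨ sym (cong₂ _+_ (sum-applyUpTo-suc (λ k → f (2 * k + 0)) m) (sum-applyUpTo-suc (λ k → f (2 * k + 1)) m)) ⟩
  sum (applyUpTo (λ k → f (2 * k + 0)) (suc m)) + sum (applyUpTo (λ k → f (2 * k + 1)) (suc m)) ∎
  where
  Evens = sum (applyUpTo (λ k → f (2 * k + 0)) m)
  Odds  = sum (applyUpTo (λ k → f (2 * k + 1)) m)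

-- For n = 2m + a and k = 2j + b:  arg n k + e = 2 (arg m j + nextOffset a b e) + offsetParity a b e
-- and n + k + c = 2 (m + j + nextCarry a b c) + carryParity a b c.
offsetShift : ℕ → ℕ → ℤ
offsetShift a b = + (8 * b) ℤ.- + (2 * a)

nextOffset : ℕ → ℕ → ℤ → ℤ
nextOffset a b e = (e ℤ.+ offsetShift a b) /ℕ 2

offsetParity : ℕ → ℕ → ℤ → ℕ
offsetParity a b e = (e ℤ.+ offsetShift a b) %ℕ 2

nextCarry : ℕ → ℕ → ℕ → ℕ
nextCarry a b c = (a + b + c) / 2

carryParity : ℕ → ℕ → ℕ → ℕ
carryParity a b c = (a + b + c) % 2

weight : ℕ → ℕ → ℤ → ℕ → Bool
weight a b e c = (carryParity a b c ≤ᵇ offsetParity a b e) ∧ (b ≤ᵇ a)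

arg-double : ∀ n k a b → arg (2 * n + a) (2 * k + b) ≡ arg n k ℤ.+ arg n k ℤ.+ offsetShift a b
arg-double n k a b = begin
  ℤ.- + (2 * (2 * n + a)) ℤ.+ + (8 * (2 * k + b))
    ≡⟨ cong₂ (λ u v → ℤ.- u ℤ.+ v) (linear 2 2 n a) (linear 8 2 k b) ⟩
  ℤ.- (+ 2 ℤ.* (+ 2 ℤ.* + n ℤ.+ + a)) ℤ.+ + 8 ℤ.* (+ 2 ℤ.* + k ℤ.+ + b)
    ≡⟨ expand (+ n) (+ k) (+ a) (+ b) ⟩
  (ℤ.- (+ 2 ℤ.* + n) ℤ.+ + 8 ℤ.* + k) ℤ.+ (ℤ.- (+ 2 ℤ.* + n) ℤ.+ + 8 ℤ.* + k) ℤ.+ (+ 8 ℤ.* + b ℤ.- + 2 ℤ.* + a)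
    ≡⟨ sym (cong₂ (λ u v → u ℤ.+ u ℤ.+ v) (cong₂ (λ u v → ℤ.- u ℤ.+ v) (pos-* 2 n) (pos-* 8 k))
                                          (cong₂ ℤ._-_ (pos-* 8 b) (pos-* 2 a))) ⟩
  arg n k ℤ.+ arg n k ℤ.+ offsetShift a b ∎
  where
  linear : ∀ c d x y → + (c * (d * x + y)) ≡ + c ℤ.* (+ d ℤ.* + x ℤ.+ + y)
  linear c d x y = trans (pos-* c (d * x + y)) (cong (+ c ℤ.*_) (trans (pos-+ (d * x) y) (cong (ℤ._+ + y) (pos-* d x))))
  expand : ∀ N K A B → ℤ.- (+ 2 ℤ.* (+ 2 ℤ.* N ℤ.+ A)) ℤ.+ + 8 ℤ.* (+ 2 ℤ.* K ℤ.+ B)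
                     ≡ (ℤ.- (+ 2 ℤ.* N) ℤ.+ + 8 ℤ.* K) ℤ.+ (ℤ.- (+ 2 ℤ.* N) ℤ.+ + 8 ℤ.* K) ℤ.+ (+ 8 ℤ.* B ℤ.- + 2 ℤ.* A)
  expand = ℤ-Solver.solve-∀

offset-split : ∀ n k a b e →
               let Y = arg n k ℤ.+ nextOffset a b e in
               arg (2 * n + a) (2 * k + b) ℤ.+ e ≡ Y ℤ.+ Y ℤ.+ + offsetParity a b e
offset-split n k a b e = begin
  arg (2 * n + a) (2 * k + b) ℤ.+ e     ≡⟨ cong (ℤ._+ e) (arg-double n k a b) ⟩
  A ℤ.+ A ℤ.+ D ℤ.+ e                   ≡⟨ regroup A D e ⟩
  A ℤ.+ A ℤ.+ (e ℤ.+ D)                 ≡⟨ cong (ℤ._+_ (A ℤ.+ A)) (a≡a%ℕn+[a/ℕn]*n (e ℤ.+ D) 2) ⟩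
  A ℤ.+ A ℤ.+ (+ r ℤ.+ e′ ℤ.* + 2)     ≡⟨ collect A e′ (+ r) ⟩
  (A ℤ.+ e′) ℤ.+ (A ℤ.+ e′) ℤ.+ + r     ∎
  where
  A = arg n k
  D = offsetShift a b
  e′ = nextOffset a b e
  r = offsetParity a b e
  regroup : ∀ A D e → A ℤ.+ A ℤ.+ D ℤ.+ e ≡ A ℤ.+ A ℤ.+ (e ℤ.+ D)
  regroup = ℤ-Solver.solve-∀
  collect : ∀ A e′ r → A ℤ.+ A ℤ.+ (r ℤ.+ e′ ℤ.* + 2) ≡ (A ℤ.+ e′) ℤ.+ (A ℤ.+ e′) ℤ.+ r
  collect = ℤ-Solver.solve-∀

carry-split : ∀ n k a b c → (2 * n + a) + (2 * k + b) + c ≡ 2 * (n + k + nextCarry a b c) + carryParity a b c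
carry-split n k a b c = begin
  (2 * n + a) + (2 * k + b) + c  ≡⟨ regroup n k a b c ⟩
  2 * (n + k) + (a + b + c)      ≡⟨ cong (_+_ (2 * (n + k))) (m≡m%n+[m/n]*n (a + b + c) 2) ⟩
  2 * (n + k) + (s + c′ * 2)     ≡⟨ collect n k c′ s ⟩
  2 * (n + k + c′) + s           ∎
  where
  c′ = nextCarry a b c
  s = carryParity a b c
  regroup : ∀ n k a b c → (2 * n + a) + (2 * k + b) + c ≡ 2 * (n + k) + (a + b + c)
  regroup = ℕ-Solver.solve-∀
  collect : ∀ n k c′ s → 2 * (n + k) + (s + c′ * 2) ≡ 2 * (n + k + c′) + s
  collect = ℕ-Solver.solve-∀

term : ℤ → ℕ → ℕ → ℕ → ℕ
term e c n k = (binomℤ (arg n k ℤ.+ e) (n + k + c) * (n C k)) % 2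

T⁺ : ℤ → ℕ → ℕ → ℕ
T⁺ e c n = sum (applyUpTo (term e c n) (suc n))

term-vanishing : ∀ e c n k → n < k → term e c n k ≡ 0
term-vanishing e c n k n<k = begin
  (B * (n C k)) % 2   ≡⟨ cong (λ v → (B * v) % 2) (k>n⇒nCk≡0 n<k) ⟩
  (B * 0) % 2         ≡⟨ cong (_% 2) (*-zeroʳ B) ⟩
  0                   ∎
  where B = binomℤ (arg n k ℤ.+ e) (n + k + c)

term-split : ∀ e c n k {a b} → a ≤ 1 → b ≤ 1 →
             term e c (2 * n + a) (2 * k + b)
               ≡ (if weight a b e c then term (nextOffset a b e) (nextCarry a b c) n k else 0)
term-split e c n k {a} {b} a≤1 b≤1 = begin
  (binomℤ (arg N K ℤ.+ e) (N + K + c) * (N C K)) % 2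
    ≡⟨ cong₂ (λ u v → (binomℤ u v * (N C K)) % 2) (offset-split n k a b e) (carry-split n k a b c) ⟩
  (binomℤ (Y ℤ.+ Y ℤ.+ + r) (2 * M + s) * (N C K)) % 2
    ≡⟨ *-cong-% {binomℤ (Y ℤ.+ Y ℤ.+ + r) (2 * M + s)} {if s ≤ᵇ r then binomℤ Y M else 0}
                {N C K} {if b ≤ᵇ a then n C k else 0} 2
         (lucas₂ℤ Y M r≤1 s≤1) (lucas₂ n k a≤1 b≤1) ⟩
  ((if s ≤ᵇ r then binomℤ Y M else 0) * (if b ≤ᵇ a then n C k else 0)) % 2
    ≡⟨ cong (_% 2) (if-* (s ≤ᵇ r) (b ≤ᵇ a) (binomℤ Y M) (n C k)) ⟩
  (if weight a b e c then binomℤ Y M * (n C k) else 0) % 2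
    ≡⟨ if-float (_% 2) (weight a b e c) ⟩
  (if weight a b e c then term (nextOffset a b e) (nextCarry a b c) n k else 0) ∎
  where
  N = 2 * n + a
  K = 2 * k + b
  Y = arg n k ℤ.+ nextOffset a b e
  M = n + k + nextCarry a b c
  r = offsetParity a b e
  s = carryParity a b c
  r≤1 : r ≤ 1
  r≤1 = ≤-pred (n%ℕd<d (e ℤ.+ offsetShift a b) 2)
  s≤1 : s ≤ 1
  s≤1 = ≤-pred (m%n<n (a + b + c) 2)

T⁺-split : ∀ e c m {a} → a ≤ 1 →
           T⁺ e c (2 * m + a)
             ≡ (if weight a 0 e c then T⁺ (nextOffset a 0 e) (nextCarry a 0 c) m else 0)
             + (if weight a 1 e c then T⁺ (nextOffset a 1 e) (nextCarry a 1 c) m else 0)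
T⁺-split e c m {a} a≤1 = begin
  sum (applyUpTo (term e c N) (suc N))
    ≡⟨ sum-applyUpTo-vanishing N<2[1+m] (term-vanishing e c N) ⟨
  sum (applyUpTo (term e c N) (2 * suc m))
    ≡⟨ sum-applyUpTo-evens-odds (term e c N) (suc m) ⟩
  sum (applyUpTo (λ k → term e c N (2 * k + 0)) (suc m)) + sum (applyUpTo (λ k → term e c N (2 * k + 1)) (suc m))
    ≡⟨ cong₂ _+_ (half z≤n) (half ≤-refl) ⟩
  (if weight a 0 e c then T⁺ (nextOffset a 0 e) (nextCarry a 0 c) m else 0)
    + (if weight a 1 e c then T⁺ (nextOffset a 1 e) (nextCarry a 1 c) m else 0) ∎
  where
  N = 2 * m + a
  N<2[1+m] : suc N ≤ 2 * suc m
  N<2[1+m] = ≤-trans (s≤s (≤-trans (+-monoʳ-≤ (2 * m) a≤1) (≤-reflexive (+-comm (2 * m) 1))))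
                     (≤-reflexive (sym (*-suc 2 m)))
  half : ∀ {b} → b ≤ 1 → sum (applyUpTo (λ k → term e c N (2 * k + b)) (suc m))
                       ≡ (if weight a b e c then T⁺ (nextOffset a b e) (nextCarry a b c) m else 0)
  half {b} b≤1 = trans (sum-applyUpTo-cong (suc m) (λ k → term-split e c m k a≤1 b≤1))
                       (sum-applyUpTo-if (weight a b e c) (term (nextOffset a b e) (nextCarry a b c) m) (suc m))

T≡T⁺ : ∀ n → T n ≡ T⁺ (+ 0) 0 n
T≡T⁺ n = trans (cong sum (map-upTo _ (suc n))) (sum-applyUpTo-cong (suc n) drop-offsets)
  where
  drop-offsets : ∀ k → (binomℤ (arg n k) (n + k) * (n C k)) % 2 ≡ term (+ 0) 0 n k
  drop-offsets k = cong₂ (λ u v → (binomℤ u v * (n C k)) % 2) (sym (ℤ-+-identityʳ (arg n k))) (sym (+-identityʳ (n + k)))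

bitsAux-fuel : ∀ {f g} n → n ≤ f → n ≤ g → bitsAux f n ≡ bitsAux g n
bitsAux-fuel {zero}  {zero}  zero    _ _ = refl
bitsAux-fuel {zero}  {suc g} zero    _ _ = refl
bitsAux-fuel {suc f} {zero}  zero    _ _ = refl
bitsAux-fuel {suc f} {suc g} zero    _ _ = refl
bitsAux-fuel {suc f} {suc g} (suc n) (s≤s n≤f) (s≤s n≤g) =
  cong (suc n % 2 ∷_) (bitsAux-fuel (suc n / 2) (≤-trans ([1+n]/2≤n n) n≤f) (≤-trans ([1+n]/2≤n n) n≤g))

bits-step : ∀ m {a} → a ≤ 1 → 0 < 2 * m + a → bits (2 * m + a) ≡ a ∷ bits m
bits-step m {a} a≤1 pos = begin
  bits (2 * m + a)                          ≡⟨ bits-nonzero (2 * m + a) pos ⟩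
  (2 * m + a) % 2 ∷ bits ((2 * m + a) / 2)  ≡⟨ cong₂ (λ d n → d ∷ bits n) ([2m+r]%2≡r m a≤1) ([2m+r]/2≡m m a≤1) ⟩
  a ∷ bits m                                ∎
  where
  bits-nonzero : ∀ n → 0 < n → bits n ≡ n % 2 ∷ bits (n / 2)
  bits-nonzero (suc n) _ = cong (suc n % 2 ∷_) (bitsAux-fuel (suc n / 2) ([1+n]/2≤n n) ≤-refl)

-- The run length transform of S at n with j ones appended below its lowest binary digit.
rlt⁺ : ℕ → ℕ → ℕ
rlt⁺ n j = product (map S (runsAux j (bits n)))

rlt⁺-zero : ∀ j → rlt⁺ 0 j ≡ S j
rlt⁺-zero zero    = refl
rlt⁺-zero (suc j) = *-identityʳ (S (suc j))

rlt⁺-odd : ∀ m j → rlt⁺ (2 * m + 1) j ≡ rlt⁺ m (suc j)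
rlt⁺-odd m j = trans (cong (product ∘ map S ∘ runsAux j) (bits-step m ≤-refl (m≤n+m 1 (2 * m)))) (extend-run j)
  where
  extend-run : ∀ j → product (map S (runsAux j (1 ∷ bits m))) ≡ rlt⁺ m (suc j)
  extend-run zero    = refl
  extend-run (suc j) = refl

rlt⁺-even : ∀ m j → rlt⁺ (2 * m + 0) j ≡ S j * rlt⁺ m 0
rlt⁺-even zero    j = trans (rlt⁺-zero j) (sym (*-identityʳ (S j)))
rlt⁺-even (suc m) j = trans (cong (product ∘ map S ∘ runsAux j) (bits-step (suc m) z≤n (s≤s z≤n))) (close-run j)
  where
  close-run : ∀ j → product (map S (runsAux j (0 ∷ bits (suc m)))) ≡ S j * rlt⁺ (suc m) 0
  close-run zero    = sym (*-identityˡ _)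
  close-run (suc j) = refl

-- S (3 + j) and S j reduce to the same term, since (3 + j) % 3 computes to j % 3.
rlt⁺-periodic : ∀ n j → rlt⁺ n (3 + j) ≡ rlt⁺ n j
rlt⁺-periodic = binary-induction (λ n → ∀ j → rlt⁺ n (3 + j) ≡ rlt⁺ n j) base step
  where
  base : ∀ j → rlt⁺ 0 (3 + j) ≡ rlt⁺ 0 j
  base j = trans (rlt⁺-zero (3 + j)) (sym (rlt⁺-zero j))
  step : ∀ m {a} → a ≤ 1 → (∀ j → rlt⁺ m (3 + j) ≡ rlt⁺ m j) → ∀ j → rlt⁺ (2 * m + a) (3 + j) ≡ rlt⁺ (2 * m + a) j
  step m {zero}        _ _  j = trans (rlt⁺-even m (3 + j)) (sym (rlt⁺-even m j))
  step m {suc zero}    _ ih j = trans (rlt⁺-odd m (3 + j)) (trans (ih (suc j)) (sym (rlt⁺-odd m j)))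
  step m {suc (suc _)} (s≤s ()) _ _

-- The reachable states (e, c) of the digit automaton

-- On these literal states T⁺-split normalises to a sum of at most two values T⁺ e′ c′ m, so each
-- field of the inductive step only names the states it comes from.
record Invariant (n : ℕ) : Set where
  field
    T⁺[-2,0] : T⁺ -[1+ 1 ] 0 n ≡ 0
    T⁺[-2,1] : T⁺ -[1+ 1 ] 1 n ≡ 0
    T⁺[-1,0] : T⁺ -[1+ 0 ] 0 n ≡ 0
    T⁺[-1,1] : T⁺ -[1+ 0 ] 1 n ≡ 0
    T⁺[0,1]  : T⁺ (+ 0) 1 n ≡ 0
    T⁺[2,1]  : T⁺ (+ 2) 1 n ≡ 0
    T⁺[0,0]  : T⁺ (+ 0) 0 n ≡ rlt⁺ n 0
    T⁺[1,0]  : T⁺ (+ 1) 0 n ≡ rlt⁺ n 0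
    T⁺[1,1]  : T⁺ (+ 1) 1 n ≡ rlt⁺ n 0
    T⁺[3,1]  : T⁺ (+ 3) 1 n ≡ rlt⁺ n 1
    T⁺[4,1]  : T⁺ (+ 4) 1 n ≡ rlt⁺ n 2
open Invariant

invariant-zero : Invariant 0
invariant-zero = record
  { T⁺[-2,0] = refl ; T⁺[-2,1] = refl ; T⁺[-1,0] = refl ; T⁺[-1,1] = refl ; T⁺[0,1] = refl ; T⁺[2,1] = refl
  ; T⁺[0,0]  = refl ; T⁺[1,0]  = refl ; T⁺[1,1]  = refl ; T⁺[3,1]  = refl ; T⁺[4,1] = refl
  }

invariant-even : ∀ m → Invariant m → Invariant (2 * m + 0)
invariant-even m ih = record
  { T⁺[-2,0] = trans (T⁺-split -[1+ 1 ] 0 m z≤n) (cong (_+ 0) (T⁺[-1,0] ih))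
  ; T⁺[-2,1] = T⁺-split -[1+ 1 ] 1 m z≤n
  ; T⁺[-1,0] = trans (T⁺-split -[1+ 0 ] 0 m z≤n) (cong (_+ 0) (T⁺[-1,0] ih))
  ; T⁺[-1,1] = trans (T⁺-split -[1+ 0 ] 1 m z≤n) (cong (_+ 0) (T⁺[-1,0] ih))
  ; T⁺[0,1]  = T⁺-split (+ 0) 1 m z≤n
  ; T⁺[2,1]  = T⁺-split (+ 2) 1 m z≤n
  ; T⁺[0,0]  = trans (T⁺-split (+ 0) 0 m z≤n) (trans (cong (_+ 0) (T⁺[0,0] ih)) (sym (rlt⁺-even m 0)))
  ; T⁺[1,0]  = trans (T⁺-split (+ 1) 0 m z≤n) (trans (cong (_+ 0) (T⁺[0,0] ih)) (sym (rlt⁺-even m 0)))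
  ; T⁺[1,1]  = trans (T⁺-split (+ 1) 1 m z≤n) (trans (cong (_+ 0) (T⁺[0,0] ih)) (sym (rlt⁺-even m 0)))
  ; T⁺[3,1]  = trans (T⁺-split (+ 3) 1 m z≤n) (trans (cong (_+ 0) (T⁺[1,0] ih)) (sym (rlt⁺-even m 1)))
  ; T⁺[4,1]  = trans (T⁺-split (+ 4) 1 m z≤n) (sym (rlt⁺-even m 2))
  }

invariant-odd : ∀ m → Invariant m → Invariant (2 * m + 1)
invariant-odd m ih = record
  { T⁺[-2,0] = trans (T⁺-split -[1+ 1 ] 0 m ≤-refl) (cong₂ _+_ refl (T⁺[2,1] ih))
  ; T⁺[-2,1] = trans (T⁺-split -[1+ 1 ] 1 m ≤-refl) (cong₂ _+_ (T⁺[-2,1] ih) refl)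
  ; T⁺[-1,0] = trans (T⁺-split -[1+ 0 ] 0 m ≤-refl) (cong₂ _+_ (T⁺[-2,0] ih) (T⁺[2,1] ih))
  ; T⁺[-1,1] = trans (T⁺-split -[1+ 0 ] 1 m ≤-refl) (cong₂ _+_ (T⁺[-2,1] ih) (T⁺[2,1] ih))
  ; T⁺[0,1]  = trans (T⁺-split (+ 0) 1 m ≤-refl) (cong₂ _+_ (T⁺[-1,1] ih) refl)
  ; T⁺[2,1]  = trans (T⁺-split (+ 2) 1 m ≤-refl) (cong₂ _+_ (T⁺[0,1] ih) refl)
  ; T⁺[0,0]  = trans (T⁺-split (+ 0) 0 m ≤-refl) (trans (cong₂ _+_ refl (T⁺[3,1] ih)) (sym (rlt⁺-odd m 0)))
  ; T⁺[1,0]  = trans (T⁺-split (+ 1) 0 m ≤-refl) (trans (cong₂ _+_ (T⁺[-1,0] ih) (T⁺[3,1] ih)) (sym (rlt⁺-odd m 0)))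
  ; T⁺[1,1]  = trans (T⁺-split (+ 1) 1 m ≤-refl) (trans (cong₂ _+_ (T⁺[-1,1] ih) (T⁺[3,1] ih)) (sym (rlt⁺-odd m 0)))
  ; T⁺[3,1]  = trans (T⁺-split (+ 3) 1 m ≤-refl) (trans (cong₂ _+_ (T⁺[0,1] ih) (T⁺[4,1] ih)) (sym (rlt⁺-odd m 1)))
  ; T⁺[4,1]  = trans (T⁺-split (+ 4) 1 m ≤-refl) (trans (cong₂ _+_ (T⁺[1,1] ih) refl)
                 (trans (+-identityʳ (rlt⁺ m 0)) (trans (sym (rlt⁺-periodic m 0)) (sym (rlt⁺-odd m 2)))))
  }

invariant : ∀ n → Invariant n
invariant = binary-induction Invariant invariant-zero step
  where
  step : ∀ m {a} → a ≤ 1 → Invariant m → Invariant (2 * m + a)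
  step m {zero}        _        = invariant-even m
  step m {suc zero}    _        = invariant-odd m
  step m {suc (suc _)} (s≤s ())

theorem15 : (n : ℕ) → T n ≡ runLengthTransform S n
theorem15 n = trans (T≡T⁺ n) (T⁺[0,0] (invariant n))
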